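{- Let $G$ be a graph whose connected components are $G_1,\ldots,G_k$, where $G_1,\ldots,G_i$ ($i\geq 0$) are isolated vertices and $G_{i+1},\ldots,G_k$ are components with at least two vertices. Then $$\operatorname{cdim}(G)=\max\{i-1,0\}+\sum_{j=i+1}^{k}\operatorname{cdim}(G_j).$$
   Context: All graphs are nonempty, finite, simple and undirected. For distinct vertices $v,w$ of a graph $G$, $\kappa(v,w)=\kappa_G(v,w)$ denotes the maximum number of internally vertex-disjoint $v$–$w$ paths in $G$ (so $\kappa(v,w)=0$ if $v,w$ lie in different components); by convention $\kappa(v,v)=\infty$. For an ordered vertex set $W=\{w_1,\ldots,w_k\}\subseteq V(G)$, the connectivity representation of $v\in V(G)$ is $r_G(v,W)=[\kappa(v,w_1),\ldots,\kappa(v,w_k)]$. The set $W$ is resolving for $G$ if $r_G(v_1,W)=r_G(v_2,W)$ implies $v_1=v_2$ for all $v_1,v_2\in V(G)$. A resolving set of minimum cardinality is a (connectivity) basis, and the connectivity dimension $\operatorname{cdim}(G)$ is the cardinality of a basis. -}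

module Defs where

open import Data.Nat using (ℕ; zero; suc; _+_; _≤_)
open import Data.Bool using (Bool; true; false)
open import Data.Fin using (Fin; splitAt)
open import Data.Fin.Subset using (Subset; _∈_; ∣_∣)
open import Data.Sum using (_⊎_; inj₁; inj₂)
open import Data.Product using (Σ; _×_; _,_)
open import Data.List using (List; []; _∷_; _++_; length; foldr)
open import Data.List.Relation.Unary.Linked using (Linked)
open import Data.List.Relation.Unary.AllPairs using (AllPairs)
open import Data.List.Relation.Unary.All using (All)
open import Data.List.Relation.Unary.Unique.Propositional using (Unique)
open import Data.List.Relation.Binary.Disjoint.Propositional using (Disjoint)
open import Relation.Binary.PropositionalEquality using (_≡_; _≢_; refl)

record Graph : Set where
  field
    size   : ℕ
    Adj    : Fin size → Fin size → Bool
    sym    : ∀ x y → Adj x y ≡ Adj y x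
    irrefl : ∀ x → Adj x x ≡ false
open Graph public

Vertex : Graph → Set
Vertex G = Fin (size G)

-- A v–w path (v ≢ w intended) is given by its list of interior vertices:
-- the vertex sequence v ∷ interior ++ [w] has no repetition and
-- consecutive vertices are adjacent.
IsPath : (G : Graph) → Vertex G → Vertex G → List (Vertex G) → Set
IsPath G v w int =
  Unique (v ∷ int ++ w ∷ []) × Linked (λ a b → Adj G a b ≡ true) (v ∷ int ++ w ∷ [])

IDPaths : (G : Graph) → Vertex G → Vertex G → List (List (Vertex G)) → Set
IDPaths G v w fam =
  All (IsPath G v w) fam × AllPairs (λ p q → p ≢ q × Disjoint p q) fam

IsMaxIDPaths : (G : Graph) → Vertex G → Vertex G → ℕ → Set
IsMaxIDPaths G v w k =
  Σ (List (List (Vertex G))) (λ fam → IDPaths G v w fam × length fam ≡ k)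
  × (∀ fam → IDPaths G v w fam → length fam ≤ k)

data ℕ∞ : Set where
  fin : ℕ → ℕ∞
  ∞   : ℕ∞

-- Kappa G v w x  :  κ_G(v,w) = x   (κ(v,v) = ∞ by convention)
data Kappa (G : Graph) (v w : Vertex G) : ℕ∞ → Set where
  same : v ≡ w → Kappa G v w ∞
  diff : ∀ {k} → v ≢ w → IsMaxIDPaths G v w k → Kappa G v w (fin k)

SameKappa : (G : Graph) → Vertex G → Vertex G → Vertex G → Set
SameKappa G v₁ v₂ w = Σ ℕ∞ (λ x → Kappa G v₁ w x × Kappa G v₂ w x)

Resolving : (G : Graph) → Subset (size G) → Set
Resolving G W = ∀ v₁ v₂ → (∀ w → w ∈ W → SameKappa G v₁ v₂ w) → v₁ ≡ v₂

IsCdim : Graph → ℕ → Set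
IsCdim G d =
  Σ (Subset (size G)) (λ W → Resolving G W × ∣ W ∣ ≡ d)
  × (∀ W → Resolving G W → d ≤ ∣ W ∣)

Connected : Graph → Set
Connected G = ∀ (v w : Vertex G) → v ≢ w → Σ (List (Vertex G)) (IsPath G v w)

K₁ : Graph
K₁ = record { size = 1 ; Adj = λ _ _ → false ; sym = λ _ _ → refl ; irrefl = λ _ → refl }

K₀ : Graph
K₀ = record { size = 0 ; Adj = λ () ; sym = λ () ; irrefl = λ () }

module _ (G H : Graph) where
  private
    adj⊕ : (a b : Fin (size G) ⊎ Fin (size H)) → Bool
    adj⊕ (inj₁ x) (inj₁ y) = Adj G x y
    adj⊕ (inj₂ x) (inj₂ y) = Adj H x y
    adj⊕ (inj₁ _) (inj₂ _) = false
    adj⊕ (inj₂ _) (inj₁ _) = false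

    sym⊕ : ∀ a b → adj⊕ a b ≡ adj⊕ b a
    sym⊕ (inj₁ x) (inj₁ y) = sym G x y
    sym⊕ (inj₂ x) (inj₂ y) = sym H x y
    sym⊕ (inj₁ _) (inj₂ _) = refl
    sym⊕ (inj₂ _) (inj₁ _) = refl

    irr⊕ : ∀ a → adj⊕ a a ≡ false
    irr⊕ (inj₁ x) = irrefl G x
    irr⊕ (inj₂ x) = irrefl H x

  _⊕_ : Graph
  _⊕_ = record
    { size = size G + size H
    ; Adj = λ x y → adj⊕ (splitAt (size G) x) (splitAt (size G) y)
    ; sym = λ x y → sym⊕ (splitAt (size G) x) (splitAt (size G) y)
    ; irrefl = λ x → irr⊕ (splitAt (size G) x)
    }

⨁ : List Graph → Graph
⨁ = foldr _⊕_ K₀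

{-# OPTIONS --safe #-}
-- A path never leaves the component of its ends, so κ between vertices of one component is
-- computed inside that component and κ between different components is 0.  Hence W₁ ∪ W₂
-- resolves G ⊕ H iff W₁ resolves G, W₂ resolves H, and no vertex of G and vertex of H both
-- have the zero representation.  In a connected graph with at least two vertices no vertex
-- has the zero representation under a resolving set, so cdim adds up over the nontrivial
-- components.  An isolated vertex has the zero representation iff it lies outside W, so at
-- most one isolated vertex can be left out of W.  This is tracked through d′, the least size
-- of a resolving set without zero representations: each isolated vertex raises d′ by one,
-- and cdim (K₁ ⊕ G) = d′ as soon as d′ ≤ cdim G + 1.
module Submission where

open import Defs hiding (sym)
open import Data.Nat using (ℕ; zero; suc; _+_; _∸_; _≤_; _<_; z≤n; s≤s)
open import Data.Nat.Properties
  using (≤-antisym; ≤-trans; ≤-reflexive; +-mono-≤; +-monoˡ-≤; m≤n+m∸n; 0≢1+n)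
open import Data.Nat.ListAction using (sum)
open import Data.Bool using (true; false)
open import Data.Empty using (⊥-elim)
open import Data.Product using (∃; _×_; _,_)
open import Data.Sum using (inj₁; inj₂)
open import Data.Fin as Fin using (Fin; _↑ˡ_; _↑ʳ_; splitAt)
open import Data.Fin.Properties
  using ( splitAt-↑ˡ; splitAt-↑ʳ; splitAt⁻¹-↑ˡ; splitAt⁻¹-↑ʳ
        ; ↑ˡ-injective; ↑ʳ-injective; fromℕ<-injective)
open import Data.Fin.Subset using (Subset; inside; outside; _∈_; _∉_; ∣_∣)
open import Data.Vec as Vec using ([]; _∷_) renaming (_++_ to _++ᵥ_)
open import Data.Vec.Properties using (lookup-++ˡ; lookup-++ʳ; []=⇒lookup; lookup⇒[]=)
open import Data.List using (List; []; _∷_; _++_; map; length; replicate)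
open import Data.List.Properties using (length-map; map-++; map-injective)
open import Data.List.Membership.Propositional.Properties using (∈-map⁺; ∈-map⁻)
open import Data.List.Relation.Unary.All as All using (All; []; _∷_)
import Data.List.Relation.Unary.All.Properties as AllP
open import Data.List.Relation.Unary.AllPairs as AllPairs using ([]; _∷_)
import Data.List.Relation.Unary.AllPairs.Properties as AllPairsP
open import Data.List.Relation.Unary.Linked as Linked using (Linked; []; _∷_)
import Data.List.Relation.Unary.Linked.Properties as LinkedP
import Data.List.Relation.Unary.Unique.Propositional.Properties as UniqueP
open import Data.List.Relation.Binary.Disjoint.Propositional using (Disjoint)
open import Data.List.Relation.Binary.Pointwise using (Pointwise; []; _∷_)
open import Relation.Nullary using (¬_)
open import Relation.Binary.PropositionalEquality using (_≡_; _≢_; refl; sym; trans; cong; cong₂; subst)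

All-image : ∀ {A B : Set} {g : A → B} {xs} →
            All (λ x → ∃ λ y → x ≡ g y) xs → ∃ λ ys → xs ≡ map g ys
All-image [] = [] , refl
All-image ((y , refl) ∷ images) with ys , refl ← All-image images = y ∷ ys , refl

Distinct : ∀ {A : Set} → List A → List A → Set
Distinct xs ys = xs ≢ ys × Disjoint xs ys

module _ {A B : Set} {f : A → B} where

  Disjoint-map⁺ : (∀ {x y} → f x ≡ f y → x ≡ y) →
                  ∀ {xs ys} → Disjoint xs ys → Disjoint (map f xs) (map f ys)
  Disjoint-map⁺ f-injective xs#ys (v∈fxs , v∈fys)
    with x , x∈xs , refl ← ∈-map⁻ f v∈fxs | y , y∈ys , fx≡fy ← ∈-map⁻ f v∈fys
    with refl ← f-injective fx≡fy = xs#ys (x∈xs , y∈ys)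

  Disjoint-map⁻ : ∀ {xs ys} → Disjoint (map f xs) (map f ys) → Disjoint xs ys
  Disjoint-map⁻ fxs#fys (x∈xs , x∈ys) = fxs#fys (∈-map⁺ f x∈xs , ∈-map⁺ f x∈ys)

  Distinct-map⁺ : (∀ {x y} → f x ≡ f y → x ≡ y) →
                  ∀ {xs ys} → Distinct xs ys → Distinct (map f xs) (map f ys)
  Distinct-map⁺ f-injective (xs≢ys , xs#ys) =
    (λ e → xs≢ys (map-injective f-injective e)) , Disjoint-map⁺ f-injective xs#ys

  Distinct-map⁻ : ∀ {xs ys} → Distinct (map f xs) (map f ys) → Distinct xs ys
  Distinct-map⁻ (fxs≢fys , fxs#fys) = (λ e → fxs≢fys (cong (map f) e)) , Disjoint-map⁻ fxs#fys

Kappa-functional : ∀ {G v w x y} → Kappa G v w x → Kappa G v w y → x ≡ y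
Kappa-functional (same _)     (same _)     = refl
Kappa-functional (same v≡w)   (diff v≢w _) = ⊥-elim (v≢w v≡w)
Kappa-functional (diff v≢w _) (same v≡w)   = ⊥-elim (v≢w v≡w)
Kappa-functional (diff _ ((fam , paths , refl) , max)) (diff _ ((fam′ , paths′ , refl) , max′)) =
  cong fin (≤-antisym (max′ fam paths) (max fam′ paths′))

SameKappa-sym : ∀ {G v₁ v₂ w} → SameKappa G v₁ v₂ w → SameKappa G v₂ v₁ w
SameKappa-sym (x , κ₁ , κ₂) = x , κ₂ , κ₁

SameKappa-transport : ∀ {G v₁ v₂ w x} →
                      SameKappa G v₁ v₂ w → Kappa G v₂ w x → Kappa G v₁ w x
SameKappa-transport (_ , κ₁ , κ₂) κ rewrite Kappa-functional κ κ₂ = κ₁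

SameRep : (G : Graph) → Subset (size G) → Vertex G → Vertex G → Set
SameRep G W v₁ v₂ = ∀ w → w ∈ W → SameKappa G v₁ v₂ w

SameRep-sym : ∀ {G W v₁ v₂} → SameRep G W v₁ v₂ → SameRep G W v₂ v₁
SameRep-sym agree w w∈W = SameKappa-sym (agree w w∈W)

ZeroRep : (G : Graph) → Subset (size G) → Vertex G → Set
ZeroRep G W v = ∀ w → w ∈ W → Kappa G v w (fin 0)

ZeroRep⇒∉ : ∀ {G W v} → ZeroRep G W v → v ∉ W
ZeroRep⇒∉ zero-rep v∈W with diff v≢v _ ← zero-rep _ v∈W = v≢v refl

ZeroFree : (G : Graph) → Subset (size G) → Set
ZeroFree G W = ∀ v → ¬ ZeroRep G W v

ResolvingZeroFree : Graph → Set
ResolvingZeroFree G = ∀ W → Resolving G W → ZeroFree G W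

IsZeroFreeCdim : Graph → ℕ → Set
IsZeroFreeCdim G d =
  ∃ (λ W → Resolving G W × ZeroFree G W × ∣ W ∣ ≡ d)
  × (∀ W → Resolving G W → ZeroFree G W → d ≤ ∣ W ∣)

module ComponentEmbedding
  {G U : Graph} (f : Vertex G → Vertex U)
  (f-injective : ∀ {a b} → f a ≡ f b → a ≡ b)
  (Adj-f : ∀ a b → Adj U (f a) (f b) ≡ Adj G a b)
  (f-closed : ∀ a y → Adj U (f a) y ≡ true → ∃ λ b → y ≡ f b)
  where

  private
    InImage : Vertex U → Set
    InImage y = ∃ λ b → y ≡ f b

    vertices-map : ∀ a b ys → f a ∷ map f ys ++ f b ∷ [] ≡ map f (a ∷ ys ++ b ∷ [])
    vertices-map a b ys = cong (f a ∷_) (sym (map-++ f ys (b ∷ [])))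

  walk-in-image : ∀ {a xs} → Linked (λ x y → Adj U x y ≡ true) (f a ∷ xs) → All InImage xs
  walk-in-image {xs = []}    _          = []
  walk-in-image {xs = y ∷ _} (e ∷ rest) with b , refl ← f-closed _ y e =
    (b , refl) ∷ walk-in-image rest

  IsPath-map⁺ : ∀ {a b ys} → IsPath G a b ys → IsPath U (f a) (f b) (map f ys)
  IsPath-map⁺ {a} {b} {ys} (unique , linked) rewrite vertices-map a b ys =
    UniqueP.map⁺ f-injective unique , LinkedP.map⁺ (Linked.map (λ {x} {y} → trans (Adj-f x y)) linked)

  IsPath-map⁻ : ∀ {a b ys} → IsPath U (f a) (f b) (map f ys) → IsPath G a b ys
  IsPath-map⁻ {a} {b} {ys} (unique , linked) rewrite vertices-map a b ys =
    UniqueP.map⁻ unique , Linked.map (λ {x} {y} → trans (sym (Adj-f x y))) (LinkedP.map⁻ linked)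

  IsPath-image : ∀ {a b int} → IsPath U (f a) (f b) int → ∃ λ ys → int ≡ map f ys
  IsPath-image {int = int} (_ , linked) = All-image (AllP.++⁻ˡ int (walk-in-image linked))

  IDPaths-map⁺ : ∀ {a b fam} → IDPaths G a b fam → IDPaths U (f a) (f b) (map (map f) fam)
  IDPaths-map⁺ (paths , distinct) =
    AllP.map⁺ (All.map IsPath-map⁺ paths) ,
    AllPairsP.map⁺ (AllPairs.map (Distinct-map⁺ f-injective) distinct)

  IDPaths-map⁻ : ∀ {a b fam} → IDPaths U (f a) (f b) (map (map f) fam) → IDPaths G a b fam
  IDPaths-map⁻ (paths , distinct) =
    All.map IsPath-map⁻ (AllP.map⁻ paths) ,
    AllPairs.map Distinct-map⁻ (AllPairsP.map⁻ distinct)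

  IDPaths-image : ∀ {a b famU} → IDPaths U (f a) (f b) famU → ∃ λ fam → famU ≡ map (map f) fam
  IDPaths-image (paths , _) = All-image (All.map IsPath-image paths)

  Kappa-map⁺ : ∀ {a b x} → Kappa G a b x → Kappa U (f a) (f b) x
  Kappa-map⁺ (same refl) = same refl
  Kappa-map⁺ {a} {b} (diff {k} a≢b ((fam , paths , length≡k) , max)) =
    diff (λ e → a≢b (f-injective e))
         ((map (map f) fam , IDPaths-map⁺ paths , trans (length-map _ fam) length≡k) , maxU)
    where
    maxU : ∀ famU → IDPaths U (f a) (f b) famU → length famU ≤ k
    maxU famU pathsU with fam′ , refl ← IDPaths-image pathsU rewrite length-map (map f) fam′ =
      max fam′ (IDPaths-map⁻ pathsU)

  Kappa-map⁻ : ∀ {a b x} → Kappa U (f a) (f b) x → Kappa G a b x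
  Kappa-map⁻ (same e) = same (f-injective e)
  Kappa-map⁻ (diff {k} ne ((famU , pathsU , length≡k) , max)) with fam , refl ← IDPaths-image pathsU =
    diff (λ e → ne (cong f e))
         ((fam , IDPaths-map⁻ pathsU , trans (sym (length-map _ fam)) length≡k) , maxG)
    where
    maxG : ∀ fam′ → IDPaths G _ _ fam′ → length fam′ ≤ k
    maxG fam′ paths′ = subst (_≤ k) (length-map _ fam′) (max _ (IDPaths-map⁺ paths′))

  SameKappa-map⁺ : ∀ {a₁ a₂ c} → SameKappa G a₁ a₂ c → SameKappa U (f a₁) (f a₂) (f c)
  SameKappa-map⁺ (x , κ₁ , κ₂) = x , Kappa-map⁺ κ₁ , Kappa-map⁺ κ₂

  SameKappa-map⁻ : ∀ {a₁ a₂ c} → SameKappa U (f a₁) (f a₂) (f c) → SameKappa G a₁ a₂ c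
  SameKappa-map⁻ (x , κ₁ , κ₂) = x , Kappa-map⁻ κ₁ , Kappa-map⁻ κ₂

  Kappa-outside : ∀ {a y} → (∀ c → y ≢ f c) → Kappa U (f a) y (fin 0)
  Kappa-outside {a} {y} y∉f = diff (λ e → y∉f a (sym e)) (([] , ([] , []) , refl) , no-paths)
    where
    no-path : ∀ {int} → ¬ IsPath U (f a) y int
    no-path {int} (_ , linked) with (c , y≡fc) ∷ _ ← AllP.++⁻ʳ int (walk-in-image linked) =
      y∉f c y≡fc

    no-paths : ∀ fam → IDPaths U (f a) y fam → length fam ≤ 0
    no-paths []      _              = z≤n
    no-paths (_ ∷ _) (path ∷ _ , _) = ⊥-elim (no-path path)

data Split (m n : ℕ) : Fin (m + n) → Set where
  left  : ∀ a → Split m n (a ↑ˡ n)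
  right : ∀ b → Split m n (m ↑ʳ b)

split : ∀ m n (x : Fin (m + n)) → Split m n x
split m n x with splitAt m x in eq
... | inj₁ a = subst (Split m n) (splitAt⁻¹-↑ˡ eq) (left a)
... | inj₂ b = subst (Split m n) (splitAt⁻¹-↑ʳ eq) (right b)

module _ {m n} (W₁ : Subset m) (W₂ : Subset n) where

  ↑ˡ∈++⁺ : ∀ {a} → a ∈ W₁ → a ↑ˡ n ∈ W₁ ++ᵥ W₂
  ↑ˡ∈++⁺ {a} a∈W₁ = lookup⇒[]= _ _ (trans (lookup-++ˡ W₁ W₂ a) ([]=⇒lookup a∈W₁))

  ↑ˡ∈++⁻ : ∀ {a} → a ↑ˡ n ∈ W₁ ++ᵥ W₂ → a ∈ W₁
  ↑ˡ∈++⁻ {a} a∈W = lookup⇒[]= _ _ (trans (sym (lookup-++ˡ W₁ W₂ a)) ([]=⇒lookup a∈W))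

  ↑ʳ∈++⁺ : ∀ {b} → b ∈ W₂ → m ↑ʳ b ∈ W₁ ++ᵥ W₂
  ↑ʳ∈++⁺ {b} b∈W₂ = lookup⇒[]= _ _ (trans (lookup-++ʳ W₁ W₂ b) ([]=⇒lookup b∈W₂))

  ↑ʳ∈++⁻ : ∀ {b} → m ↑ʳ b ∈ W₁ ++ᵥ W₂ → b ∈ W₂
  ↑ʳ∈++⁻ {b} b∈W = lookup⇒[]= _ _ (trans (sym (lookup-++ʳ W₁ W₂ b)) ([]=⇒lookup b∈W))

∣++∣ : ∀ {m n} (W₁ : Subset m) (W₂ : Subset n) → ∣ W₁ ++ᵥ W₂ ∣ ≡ ∣ W₁ ∣ + ∣ W₂ ∣
∣++∣ []             W₂ = refl
∣++∣ (inside ∷ W₁)  W₂ = cong suc (∣++∣ W₁ W₂)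
∣++∣ (outside ∷ W₁) W₂ = ∣++∣ W₁ W₂

elim-++ : ∀ {m n} {P : Subset (m + n) → Set} → (∀ W₁ W₂ → P (W₁ ++ᵥ W₂)) → ∀ W → P W
elim-++ {m} h W with W₁ , W₂ , refl ← Vec.splitAt m W = h W₁ W₂

module Union (G H : Graph) where

  private
    m = size G
    n = size H

  inl : Vertex G → Vertex (G ⊕ H)
  inl a = a ↑ˡ n

  inr : Vertex H → Vertex (G ⊕ H)
  inr b = m ↑ʳ b

  inl-injective : ∀ {a₁ a₂} → inl a₁ ≡ inl a₂ → a₁ ≡ a₂
  inl-injective = ↑ˡ-injective n _ _

  inr-injective : ∀ {b₁ b₂} → inr b₁ ≡ inr b₂ → b₁ ≡ b₂
  inr-injective = ↑ʳ-injective m _ _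

  inl≢inr : ∀ a b → inl a ≢ inr b
  inl≢inr a b e
    with () ← trans (sym (splitAt-↑ˡ m a n)) (trans (cong (splitAt m) e) (splitAt-↑ʳ m n b))

  Adj-inl-inl : ∀ a₁ a₂ → Adj (G ⊕ H) (inl a₁) (inl a₂) ≡ Adj G a₁ a₂
  Adj-inl-inl a₁ a₂ rewrite splitAt-↑ˡ m a₁ n | splitAt-↑ˡ m a₂ n = refl

  Adj-inr-inr : ∀ b₁ b₂ → Adj (G ⊕ H) (inr b₁) (inr b₂) ≡ Adj H b₁ b₂
  Adj-inr-inr b₁ b₂ rewrite splitAt-↑ʳ m n b₁ | splitAt-↑ʳ m n b₂ = refl

  Adj-inl-inr : ∀ a b → Adj (G ⊕ H) (inl a) (inr b) ≡ false
  Adj-inl-inr a b rewrite splitAt-↑ˡ m a n | splitAt-↑ʳ m n b = refl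

  Adj-inr-inl : ∀ b a → Adj (G ⊕ H) (inr b) (inl a) ≡ false
  Adj-inr-inl b a rewrite splitAt-↑ʳ m n b | splitAt-↑ˡ m a n = refl

  inl-closed : ∀ a y → Adj (G ⊕ H) (inl a) y ≡ true → ∃ λ c → y ≡ inl c
  inl-closed a y e with split m n y
  ... | left c  = c , refl
  ... | right d with () ← trans (sym (Adj-inl-inr a d)) e

  inr-closed : ∀ b y → Adj (G ⊕ H) (inr b) y ≡ true → ∃ λ d → y ≡ inr d
  inr-closed b y e with split m n y
  ... | right d = d , refl
  ... | left c  with () ← trans (sym (Adj-inr-inl b c)) e

  module L = ComponentEmbedding {G} {G ⊕ H} inl inl-injective Adj-inl-inl inl-closed
  module R = ComponentEmbedding {H} {G ⊕ H} inr inr-injective Adj-inr-inr inr-closed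

  Kappa-inl-inr : ∀ a b → Kappa (G ⊕ H) (inl a) (inr b) (fin 0)
  Kappa-inl-inr a b = L.Kappa-outside (λ c e → inl≢inr c b (sym e))

  Kappa-inr-inl : ∀ b a → Kappa (G ⊕ H) (inr b) (inl a) (fin 0)
  Kappa-inr-inl b a = R.Kappa-outside (inl≢inr a)

  module _ (W₁ : Subset m) (W₂ : Subset n) where

    SameRep-inl⁺ : ∀ {a₁ a₂} →
                   SameRep G W₁ a₁ a₂ → SameRep (G ⊕ H) (W₁ ++ᵥ W₂) (inl a₁) (inl a₂)
    SameRep-inl⁺ agree w w∈W with split m n w
    ... | left c  = L.SameKappa-map⁺ (agree c (↑ˡ∈++⁻ W₁ W₂ w∈W))
    ... | right d = fin 0 , Kappa-inl-inr _ d , Kappa-inl-inr _ d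

    SameRep-inr⁺ : ∀ {b₁ b₂} →
                   SameRep H W₂ b₁ b₂ → SameRep (G ⊕ H) (W₁ ++ᵥ W₂) (inr b₁) (inr b₂)
    SameRep-inr⁺ agree w w∈W with split m n w
    ... | left c  = fin 0 , Kappa-inr-inl _ c , Kappa-inr-inl _ c
    ... | right d = R.SameKappa-map⁺ (agree d (↑ʳ∈++⁻ W₁ W₂ w∈W))

    SameRep-inl⁻ : ∀ {a₁ a₂} →
                   SameRep (G ⊕ H) (W₁ ++ᵥ W₂) (inl a₁) (inl a₂) → SameRep G W₁ a₁ a₂
    SameRep-inl⁻ agree c c∈W₁ = L.SameKappa-map⁻ (agree (inl c) (↑ˡ∈++⁺ W₁ W₂ c∈W₁))

    SameRep-inr⁻ : ∀ {b₁ b₂} →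
                   SameRep (G ⊕ H) (W₁ ++ᵥ W₂) (inr b₁) (inr b₂) → SameRep H W₂ b₁ b₂
    SameRep-inr⁻ agree d d∈W₂ = R.SameKappa-map⁻ (agree (inr d) (↑ʳ∈++⁺ W₁ W₂ d∈W₂))

    ZeroRep-inl⁺ : ∀ {a} → ZeroRep G W₁ a → ZeroRep (G ⊕ H) (W₁ ++ᵥ W₂) (inl a)
    ZeroRep-inl⁺ zero-rep w w∈W with split m n w
    ... | left c  = L.Kappa-map⁺ (zero-rep c (↑ˡ∈++⁻ W₁ W₂ w∈W))
    ... | right d = Kappa-inl-inr _ d

    ZeroRep-inr⁺ : ∀ {b} → ZeroRep H W₂ b → ZeroRep (G ⊕ H) (W₁ ++ᵥ W₂) (inr b)
    ZeroRep-inr⁺ zero-rep w w∈W with split m n w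
    ... | left c  = Kappa-inr-inl _ c
    ... | right d = R.Kappa-map⁺ (zero-rep d (↑ʳ∈++⁻ W₁ W₂ w∈W))

    ZeroRep-inl⁻ : ∀ {a} → ZeroRep (G ⊕ H) (W₁ ++ᵥ W₂) (inl a) → ZeroRep G W₁ a
    ZeroRep-inl⁻ zero-rep c c∈W₁ = L.Kappa-map⁻ (zero-rep (inl c) (↑ˡ∈++⁺ W₁ W₂ c∈W₁))

    ZeroRep-inr⁻ : ∀ {b} → ZeroRep (G ⊕ H) (W₁ ++ᵥ W₂) (inr b) → ZeroRep H W₂ b
    ZeroRep-inr⁻ zero-rep d d∈W₂ = R.Kappa-map⁻ (zero-rep (inr d) (↑ʳ∈++⁺ W₁ W₂ d∈W₂))

    SameRep-inl-inr⁺ : ∀ {a b} →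
                       ZeroRep G W₁ a → ZeroRep H W₂ b → SameRep (G ⊕ H) (W₁ ++ᵥ W₂) (inl a) (inr b)
    SameRep-inl-inr⁺ zero-a zero-b w w∈W =
      fin 0 , ZeroRep-inl⁺ zero-a w w∈W , ZeroRep-inr⁺ zero-b w w∈W

    SameRep-inl-inr⁻ : ∀ {a b} →
                       SameRep (G ⊕ H) (W₁ ++ᵥ W₂) (inl a) (inr b) → ZeroRep G W₁ a × ZeroRep H W₂ b
    SameRep-inl-inr⁻ {a} {b} agree = zero-a , zero-b
      where
      zero-a : ZeroRep G W₁ a
      zero-a c c∈W₁ =
        L.Kappa-map⁻ (SameKappa-transport (agree (inl c) (↑ˡ∈++⁺ W₁ W₂ c∈W₁)) (Kappa-inr-inl b c))

      zero-b : ZeroRep H W₂ b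
      zero-b d d∈W₂ =
        R.Kappa-map⁻ (SameKappa-transport (SameKappa-sym (agree (inr d) (↑ʳ∈++⁺ W₁ W₂ d∈W₂))) (Kappa-inl-inr a d))

    Separated : Set
    Separated = ∀ a b → ¬ (ZeroRep G W₁ a × ZeroRep H W₂ b)

    separated-zeroFreeˡ : ZeroFree G W₁ → Separated
    separated-zeroFreeˡ zero-free a _ (zero-a , _) = zero-free a zero-a

    separated-zeroFreeʳ : ZeroFree H W₂ → Separated
    separated-zeroFreeʳ zero-free _ b (_ , zero-b) = zero-free b zero-b

    resolving-⊕⁻ : Resolving (G ⊕ H) (W₁ ++ᵥ W₂) →
                   Resolving G W₁ × Resolving H W₂ × Separated
    resolving-⊕⁻ resolving =
      (λ a₁ a₂ agree → inl-injective (resolving _ _ (SameRep-inl⁺ agree))) ,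
      (λ b₁ b₂ agree → inr-injective (resolving _ _ (SameRep-inr⁺ agree))) ,
      (λ a b (zero-a , zero-b) → inl≢inr a b (resolving _ _ (SameRep-inl-inr⁺ zero-a zero-b)))

    resolving-⊕⁺ : Resolving G W₁ → Resolving H W₂ → Separated →
                   Resolving (G ⊕ H) (W₁ ++ᵥ W₂)
    resolving-⊕⁺ resolving-G resolving-H separated v₁ v₂ agree with split m n v₁ | split m n v₂
    ... | left a₁  | left a₂  = cong inl (resolving-G a₁ a₂ (SameRep-inl⁻ agree))
    ... | right b₁ | right b₂ = cong inr (resolving-H b₁ b₂ (SameRep-inr⁻ agree))
    ... | left a   | right b  = ⊥-elim (separated a b (SameRep-inl-inr⁻ agree))
    ... | right b  | left a   = ⊥-elim (separated a b (SameRep-inl-inr⁻ (SameRep-sym agree)))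

    zeroFree-⊕⁺ : ZeroFree G W₁ → ZeroFree H W₂ → ZeroFree (G ⊕ H) (W₁ ++ᵥ W₂)
    zeroFree-⊕⁺ zero-free-G zero-free-H v zero-rep with split m n v
    ... | left a  = zero-free-G a (ZeroRep-inl⁻ zero-rep)
    ... | right b = zero-free-H b (ZeroRep-inr⁻ zero-rep)

    zeroFree-⊕⁻ : ZeroFree (G ⊕ H) (W₁ ++ᵥ W₂) → ZeroFree G W₁ × ZeroFree H W₂
    zeroFree-⊕⁻ zero-free =
      (λ a zero-rep → zero-free (inl a) (ZeroRep-inl⁺ zero-rep)) ,
      (λ b zero-rep → zero-free (inr b) (ZeroRep-inr⁺ zero-rep))

cdim-⊕ : ∀ {G H d e} → ResolvingZeroFree G → IsCdim G d → IsCdim H e → IsCdim (G ⊕ H) (d + e)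
cdim-⊕ {G} {H} {d} {e} zero-free-G ((B , resolving-B , ∣B∣) , min-G) ((C , resolving-C , ∣C∣) , min-H) =
  (B ++ᵥ C ,
   resolving-⊕⁺ B C resolving-B resolving-C (separated-zeroFreeˡ B C (zero-free-G B resolving-B)) ,
   trans (∣++∣ B C) (cong₂ _+_ ∣B∣ ∣C∣)) ,
  elim-++ lower-bound
  where
  open Union G H
  lower-bound : ∀ (W₁ : Subset (size G)) (W₂ : Subset (size H)) →
                Resolving (G ⊕ H) (W₁ ++ᵥ W₂) → d + e ≤ ∣ W₁ ++ᵥ W₂ ∣
  lower-bound W₁ W₂ resolving with resolving-G , resolving-H , _ ← resolving-⊕⁻ W₁ W₂ resolving =
    ≤-trans (+-mono-≤ (min-G W₁ resolving-G) (min-H W₂ resolving-H)) (≤-reflexive (sym (∣++∣ W₁ W₂)))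

resolvingZeroFree-⊕ : ∀ {G H} → ResolvingZeroFree G → ResolvingZeroFree H → ResolvingZeroFree (G ⊕ H)
resolvingZeroFree-⊕ {G} {H} zero-free-G zero-free-H = elim-++ λ W₁ W₂ resolving →
  let resolving-G , resolving-H , _ = resolving-⊕⁻ W₁ W₂ resolving
  in  zeroFree-⊕⁺ W₁ W₂ (zero-free-G W₁ resolving-G) (zero-free-H W₂ resolving-H)
  where open Union G H

Kappa-connected : ∀ {G v w} → Connected G → ¬ Kappa G v w (fin 0)
Kappa-connected connected (diff v≢w (_ , max)) with path , is-path ← connected _ _ v≢w
  with () ← max (path ∷ []) ((is-path ∷ []) , ([] ∷ []))

-- Connectivity forces a zero representation to come from W = ∅, which cannot separate two vertices.
connected⇒resolvingZeroFree : ∀ {G} → 2 ≤ size G → Connected G → ResolvingZeroFree G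
connected⇒resolvingZeroFree {G} 2≤size connected W resolving v zero-rep =
  0≢1+n (fromℕ<-injective 0 1 (≤-trans (s≤s z≤n) 2≤size) 2≤size
                            (trans (everything≡v _) (sym (everything≡v _))))
  where
  everything≡v : ∀ u → u ≡ v
  everything≡v u = resolving u v λ w w∈W → ⊥-elim (Kappa-connected connected (zero-rep w w∈W))

resolving-K₁ : ∀ W → Resolving K₁ W
resolving-K₁ _ Fin.zero Fin.zero _ = refl

zeroRep-K₁ : ZeroRep K₁ (outside ∷ []) Fin.zero
zeroRep-K₁ Fin.zero ()

zeroFree-K₁ : ZeroFree K₁ (inside ∷ [])
zeroFree-K₁ Fin.zero zero-rep = ZeroRep⇒∉ zero-rep Vec.here

zeroFreeCdim-K₁⊕ : ∀ {G d} → IsZeroFreeCdim G d → IsZeroFreeCdim (K₁ ⊕ G) (suc d)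
zeroFreeCdim-K₁⊕ {G} {d} ((B , resolving-B , zero-free-B , ∣B∣) , min) =
  (inside ∷ B ,
   resolving-⊕⁺ (inside ∷ []) B (resolving-K₁ _) resolving-B (separated-zeroFreeʳ (inside ∷ []) B zero-free-B) ,
   zeroFree-⊕⁺ (inside ∷ []) B zeroFree-K₁ zero-free-B ,
   cong suc ∣B∣) ,
  elim-++ lower-bound
  where
  open Union K₁ G
  lower-bound : ∀ (W₁ : Subset 1) (W₂ : Subset (size G)) →
                Resolving (K₁ ⊕ G) (W₁ ++ᵥ W₂) → ZeroFree (K₁ ⊕ G) (W₁ ++ᵥ W₂) → suc d ≤ ∣ W₁ ++ᵥ W₂ ∣
  lower-bound (inside ∷ []) W₂ resolving zero-free
    with _ , resolving-G , _ ← resolving-⊕⁻ _ W₂ resolving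
       | _ , zero-free-G ← zeroFree-⊕⁻ _ W₂ zero-free =
    s≤s (min W₂ resolving-G zero-free-G)
  lower-bound (outside ∷ []) W₂ _ zero-free with zero-free-K₁ , _ ← zeroFree-⊕⁻ _ W₂ zero-free =
    ⊥-elim (zero-free-K₁ Fin.zero zeroRep-K₁)

cdim-K₁⊕ : ∀ {G d d′} → IsCdim G d → IsZeroFreeCdim G d′ → d′ ≤ suc d → IsCdim (K₁ ⊕ G) d′
cdim-K₁⊕ {G} {d} {d′} (_ , min) ((B , resolving-B , zero-free-B , ∣B∣) , min-zero-free) d′≤1+d =
  (outside ∷ B ,
   resolving-⊕⁺ (outside ∷ []) B (resolving-K₁ _) resolving-B (separated-zeroFreeʳ (outside ∷ []) B zero-free-B) ,
   ∣B∣) ,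
  elim-++ lower-bound
  where
  open Union K₁ G
  lower-bound : ∀ (W₁ : Subset 1) (W₂ : Subset (size G)) →
                Resolving (K₁ ⊕ G) (W₁ ++ᵥ W₂) → d′ ≤ ∣ W₁ ++ᵥ W₂ ∣
  lower-bound (inside ∷ []) W₂ resolving with _ , resolving-G , _ ← resolving-⊕⁻ _ W₂ resolving =
    ≤-trans d′≤1+d (s≤s (min W₂ resolving-G))
  lower-bound (outside ∷ []) W₂ resolving with _ , resolving-G , separated ← resolving-⊕⁻ _ W₂ resolving =
    min-zero-free W₂ resolving-G (λ b zero-b → separated Fin.zero b (zeroRep-K₁ , zero-b))

zeroFreeCdim : ∀ {G d} → IsCdim G d → ResolvingZeroFree G → IsZeroFreeCdim G d
zeroFreeCdim ((B , resolving-B , ∣B∣) , min) zero-free =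
  (B , resolving-B , zero-free B resolving-B , ∣B∣) , λ W resolving _ → min W resolving

cdim-⨁ : ∀ {Hs ds} → All (λ H → 2 ≤ size H × Connected H) Hs → Pointwise IsCdim Hs ds →
         IsCdim (⨁ Hs) (sum ds) × ResolvingZeroFree (⨁ Hs)
cdim-⨁ [] [] = (([] , (λ ()) , refl) , λ _ _ → z≤n) , λ _ _ ()
cdim-⨁ ((2≤size , connected) ∷ nontrivial) (cdim ∷ cdims) =
  let cdim-rest , zero-free-rest = cdim-⨁ nontrivial cdims
      zero-free = connected⇒resolvingZeroFree 2≤size connected
  in  cdim-⊕ zero-free cdim cdim-rest , resolvingZeroFree-⊕ zero-free zero-free-rest

zeroFreeCdim-⨁-K₁s : ∀ i {Hs d} →
                     IsZeroFreeCdim (⨁ Hs) d → IsZeroFreeCdim (⨁ (replicate i K₁ ++ Hs)) (i + d)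
zeroFreeCdim-⨁-K₁s zero    zero-free-cdim = zero-free-cdim
zeroFreeCdim-⨁-K₁s (suc i) zero-free-cdim = zeroFreeCdim-K₁⊕ (zeroFreeCdim-⨁-K₁s i zero-free-cdim)

cdim-⨁-K₁s : ∀ i {Hs d} → IsCdim (⨁ Hs) d → IsZeroFreeCdim (⨁ Hs) d →
             IsCdim (⨁ (replicate i K₁ ++ Hs)) (i ∸ 1 + d)
cdim-⨁-K₁s zero    cdim _ = cdim
cdim-⨁-K₁s (suc i) {d = d} cdim zero-free-cdim =
  cdim-K₁⊕ (cdim-⨁-K₁s i cdim zero-free-cdim) (zeroFreeCdim-⨁-K₁s i zero-free-cdim)
           (+-monoˡ-≤ d (m≤n+m∸n i 1))

lemma2p1 : (i : ℕ) (Hs : List Graph) (ds : List ℕ)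
    → All (λ H → 2 ≤ size H × Connected H) Hs
    → Pointwise IsCdim Hs ds
    → 0 < i + length Hs
    → IsCdim (⨁ (replicate i K₁ ++ Hs)) ((i ∸ 1) + sum ds)
lemma2p1 i Hs ds nontrivial cdims _ =
  let cdim , zero-free = cdim-⨁ nontrivial cdims
  in  cdim-⨁-K₁s i cdim (zeroFreeCdim cdim zero-free)
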